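{- Let $n,c,k$ be positive integers with $kc\le\lfloor n/2\rfloor$ and let $G=Ci(n,\{c,2c,\dots,kc\})$. If $G$ is closed distance magic, then $n=2kc$ or $n=(2k+1)c$.
   Context: For $S\subseteq\{1,\dots,\lfloor n/2\rfloor\}$, the circulant graph $Ci(n,S)$ has vertex set $\{v_0,\dots,v_{n-1}\}$, with $v_i$ adjacent to $v_j$ iff $|i-j|\in S$. A graph on $n$ vertices is closed distance magic if there is a bijection $\ell\colon V\to\{1,\dots,n\}$ and a positive integer $k'$ such that the sum of $\ell$ over the closed neighborhood $N[x]$ ($x$ and its neighbors) of every vertex $x$ equals $k'$. -}

module Defs where

open import Data.Nat using (ℕ; zero; suc; _+_; _*_; _∸_; _⊓_; ∣_-_∣; _≡ᵇ_; _<_; _≤_)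
open import Data.Bool using (Bool; _∨_; if_then_else_)
open import Data.Fin using (Fin; toℕ)
open import Data.List using (List; upTo; map; allFin)
open import Data.Bool.ListAction using (any)
open import Data.Nat.ListAction using (sum)
open import Data.Product using (∃; _×_)
open import Function.Bundles using (_⤖_; Bijection)
open import Relation.Binary.PropositionalEquality using (_≡_)

inMultSet : (c k d : ℕ) → Bool
inMultSet c k d = any (λ m → d ≡ᵇ (suc m * c)) (upTo k)

cdist : (n : ℕ) → Fin n → Fin n → ℕ
cdist n i j = ∣ toℕ i - toℕ j ∣ ⊓ (n ∸ ∣ toℕ i - toℕ j ∣)

inClosedNbhd : (n c k : ℕ) → Fin n → Fin n → Bool
inClosedNbhd n c k v x = (toℕ v ≡ᵇ toℕ x) ∨ inMultSet c k (cdist n v x)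

-- labelling ℓ : V → {1..n} encoded as a bijection Fin n ⤖ Fin n, label of x is toℕ (ℓ x) + 1
closedNbhdSum : (n c k : ℕ) → (Fin n → Fin n) → Fin n → ℕ
closedNbhdSum n c k ℓ v =
  sum (map (λ x → if inClosedNbhd n c k v x then suc (toℕ (ℓ x)) else 0) (allFin n))

CirculantClosedDistanceMagic : (n c k : ℕ) → Set
CirculantClosedDistanceMagic n c k =
  ∃ λ (ℓ : Fin n ⤖ Fin n) → ∃ λ (k' : ℕ) →
    (0 < k') × (∀ v → closedNbhdSum n c k (Bijection.to ℓ) v ≡ k')

module Submission where

-- Write n = 2kc + s, which kc ≤ ⌊n/2⌋ allows. In ℤ_n the closed neighbourhood N[v_c] is
-- N[v₀] = {jc : |j| ≤ k} shifted by c, so unless s = 0 or s = c the two differ in exactly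
-- one vertex each: v_(k+1)c lies only in N[v_c] and v_(n−kc) only in N[v₀]. Equal
-- neighbourhood sums then force these two distinct vertices to carry the same label.

open import Defs
open import Data.Nat using (ℕ; _*_; _+_; _/_; _≤_; _<_)
open import Data.Sum using (_⊎_)
open import Relation.Binary.PropositionalEquality using (_≡_)

open import Data.Bool using (Bool; true; false; T; if_then_else_)
open import Data.Bool.Properties using (T-∨; T-≡; ¬-not; ⇔→≡)
open import Data.Fin using (Fin; zero; suc; toℕ; fromℕ<)
import Data.Fin as Fin
open import Data.Fin.Properties using (toℕ<n; toℕ-fromℕ<; toℕ-injective)
open import Data.List using (upTo; map; tabulate)
open import Data.List.Membership.Propositional using (find; lose)
open import Data.List.Membership.Propositional.Properties using (∈-upTo⁺; ∈-upTo⁻)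
open import Data.List.Relation.Unary.Any.Properties using (any⁺; any⁻)
open import Data.Nat using (zero; suc; _∸_; _⊓_; ∣_-_∣; z≤n; z<s; >-nonZero)
open import Data.Nat.DivMod using (m/n*n≤m)
open import Data.Nat.ListAction using (sum)
open import Data.Nat.Properties
open import Data.Nat.Tactic.RingSolver using (solve-∀)
open import Data.Product using (∃-syntax; _×_; _,_)
open import Data.Sum using (inj₁; inj₂)
open import Data.Vec.Functional using (Vector)
open import Function using (_∘_; id; _⇔_; mk⇔; Equivalence)
open import Function.Bundles using (Bijection)
import Function.Properties.Equivalence as ⇔
open import Relation.Nullary using (¬_; does; yes; no; contradiction)
open import Relation.Binary.PropositionalEquality

open import Algebra.Properties.CommutativeMonoid.Sum +-0-commutativeMonoid
  using (∑-distrib-+; sum-cong-≗; sum-replicate-zero) renaming (sum to ∑)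
open import Algebra.Properties.CommutativeSemigroup +-commutativeSemigroup using (xy∙z≈y∙xz)

-- For D < n: D ≡ ±jc (mod n) for some 0 ≤ j ≤ k, i.e. v_D ∈ N[v₀].
SignedMultiple : (n c k D : ℕ) → Set
SignedMultiple n c k D = ∃[ j ] j ≤ k × (D ≡ j * c ⊎ D + j * c ≡ n)

T-inMultSet⇔ : ∀ c k d → T (inMultSet c k d) ⇔ (∃[ i ] i < k × d ≡ suc i * c)
T-inMultSet⇔ c k d = mk⇔ to from
  where
  to : T (inMultSet c k d) → ∃[ i ] i < k × d ≡ suc i * c
  to t with i , i∈ , d≡ᵇ ← find (any⁻ _ (upTo k) t) = i , ∈-upTo⁻ i∈ , ≡ᵇ⇒≡ d _ d≡ᵇ
  from : ∃[ i ] i < k × d ≡ suc i * c → T (inMultSet c k d)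
  from (i , i<k , d≡) = any⁺ _ (lose (∈-upTo⁺ i<k) (≡⇒≡ᵇ d _ d≡))

≤-half⇒≤-complement : ∀ {m h n} → m ≤ h → h + h ≤ n → m ≤ n ∸ m
≤-half⇒≤-complement {m} {h} {n} m≤h h+h≤n = begin
  m      ≤⟨ m≤h ⟩
  h      ≤⟨ m+n≤o⇒m≤o∸n h h+h≤n ⟩
  n ∸ h  ≤⟨ ∸-monoʳ-≤ n m≤h ⟩
  n ∸ m  ∎
  where open ≤-Reasoning

⊓-complement≡⇔ : ∀ {m h n D} → m ≤ h → h + h ≤ n → D ≤ n →
  D ⊓ (n ∸ D) ≡ m ⇔ (D ≡ m ⊎ D + m ≡ n)
⊓-complement≡⇔ {m} {h} {n} {D} m≤h h+h≤n D≤n = mk⇔ to from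
  where
  to : D ⊓ (n ∸ D) ≡ m → D ≡ m ⊎ D + m ≡ n
  to eq with ⊓-sel D (n ∸ D)
  ... | inj₁ ⊓≡D = inj₁ (trans (sym ⊓≡D) eq)
  ... | inj₂ ⊓≡n∸D = inj₂ (subst (λ x → D + x ≡ n) (trans (sym ⊓≡n∸D) eq) (m+[n∸m]≡n D≤n))
  from : D ≡ m ⊎ D + m ≡ n → D ⊓ (n ∸ D) ≡ m
  from (inj₁ refl) = m≤n⇒m⊓n≡m (≤-half⇒≤-complement m≤h h+h≤n)
  from (inj₂ refl) rewrite m+n∸m≡n D m = m≥n⇒m⊓n≡n m≤D
    where
    m≤D : m ≤ D
    m≤D = subst (m ≤_) (m+n∸n≡m D m) (≤-half⇒≤-complement m≤h h+h≤n)

∣toℕ-toℕ∣<n : ∀ {n} (v x : Fin n) → ∣ toℕ v - toℕ x ∣ < n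
∣toℕ-toℕ∣<n v x = ≤-<-trans (∣m-n∣≤m⊔n (toℕ v) (toℕ x)) (⊔-pres-<m (toℕ<n v) (toℕ<n x))

inClosedNbhd≡true⇔ : ∀ {n c k} → k * c + k * c ≤ n → (v x : Fin n) →
  inClosedNbhd n c k v x ≡ true ⇔ SignedMultiple n c k ∣ toℕ v - toℕ x ∣
inClosedNbhd≡true⇔ {n} {c} {k} kc+kc≤n v x = ⇔.trans (⇔.sym T-≡) (mk⇔ to from)
  where
  D = ∣ toℕ v - toℕ x ∣
  D<n = ∣toℕ-toℕ∣<n v x
  cdist≡⇔ : ∀ {i} → i < k → cdist n v x ≡ suc i * c ⇔ (D ≡ suc i * c ⊎ D + suc i * c ≡ n)
  cdist≡⇔ i<k = ⊓-complement≡⇔ (*-monoˡ-≤ c i<k) kc+kc≤n (<⇒≤ D<n)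
  to : T (inClosedNbhd n c k v x) → SignedMultiple n c k D
  to t with Equivalence.to T-∨ t
  ... | inj₁ v≡x = 0 , z≤n , inj₁ (m≡n⇒∣m-n∣≡0 (≡ᵇ⇒≡ (toℕ v) (toℕ x) v≡x))
  ... | inj₂ t′ with i , i<k , eq ← Equivalence.to (T-inMultSet⇔ c k _) t′ =
    suc i , i<k , Equivalence.to (cdist≡⇔ i<k) eq
  from : SignedMultiple n c k D → T (inClosedNbhd n c k v x)
  from (zero , _ , inj₁ D≡0) = Equivalence.from T-∨ (inj₁ (≡⇒≡ᵇ (toℕ v) (toℕ x) (∣m-n∣≡0⇒m≡n D≡0)))
  from (zero , _ , inj₂ D+0≡n) = contradiction (trans (sym (+-identityʳ D)) D+0≡n) (<⇒≢ D<n)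
  from (suc i , i<k , e) = Equivalence.from T-∨
    (inj₂ (Equivalence.from (T-inMultSet⇔ c k _) (i , i<k , Equivalence.from (cdist≡⇔ i<k) e)))

m+n≡o+p∧n≤o⇒p≤m : ∀ {m n o p} → m + n ≡ o + p → n ≤ o → p ≤ m
m+n≡o+p∧n≤o⇒p≤m {m} {n} {o} {p} eq n≤o = +-cancelʳ-≤ n p m (begin
  p + n  ≤⟨ +-monoʳ-≤ p n≤o ⟩
  p + o  ≡⟨ +-comm p o ⟩
  o + p  ≡⟨ eq ⟨
  m + n  ∎)
  where open ≤-Reasoning

restrict : ∀ {n} → (Fin n → Bool) → Vector ℕ n → Vector ℕ n
restrict A h x = if A x then h x else 0

sum-map-tabulate : ∀ {a} {A : Set a} {n} (g : Fin n → A) (f : A → ℕ) →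
  sum (map f (tabulate g)) ≡ ∑ (f ∘ g)
sum-map-tabulate {n = zero} g f = refl
sum-map-tabulate {n = suc n} g f = cong (f (g zero) +_) (sum-map-tabulate (g ∘ suc) f)

pointMass : ∀ {n} → Fin n → Vector ℕ n → Vector ℕ n
pointMass i = restrict (λ x → does (x Fin.≟ i))

sum-pointMass : ∀ {n} (i : Fin n) (h : Vector ℕ n) → ∑ (pointMass i h) ≡ h i
sum-pointMass {suc n} zero h = trans (cong (h zero +_) (sum-replicate-zero n)) (+-identityʳ (h zero))
sum-pointMass {suc n} (suc i) h = sum-pointMass i (h ∘ suc)

sum-restrict-exchange : ∀ {n} (h : Vector ℕ n) (A B : Fin n → Bool) {p q : Fin n} →
  A p ≡ false → B p ≡ true → A q ≡ true → B q ≡ false →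
  (∀ x → x ≢ p → x ≢ q → A x ≡ B x) →
  ∑ (restrict A h) + h p ≡ ∑ (restrict B h) + h q
sum-restrict-exchange h A B {p} {q} Ap Bp Aq Bq A≡B = begin
  ∑ (restrict A h) + h p                             ≡⟨ cong (_ +_) (sum-pointMass p h) ⟨
  ∑ (restrict A h) + ∑ (pointMass p h)               ≡⟨ ∑-distrib-+ (restrict A h) _ ⟨
  ∑ (λ x → restrict A h x + pointMass p h x)         ≡⟨ sum-cong-≗ pointwise ⟩
  ∑ (λ x → restrict B h x + pointMass q h x)         ≡⟨ ∑-distrib-+ (restrict B h) _ ⟩
  ∑ (restrict B h) + ∑ (pointMass q h)               ≡⟨ cong (_ +_) (sum-pointMass q h) ⟩
  ∑ (restrict B h) + h q                             ∎
  where
  open ≡-Reasoning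
  pointwise : ∀ x → restrict A h x + pointMass p h x ≡ restrict B h x + pointMass q h x
  pointwise x with x Fin.≟ p | x Fin.≟ q
  ... | yes refl | yes refl = contradiction (trans (sym Ap) Aq) λ ()
  ... | yes refl | no _     rewrite Ap | Bp = sym (+-identityʳ _)
  ... | no _     | yes refl rewrite Aq | Bq = +-identityʳ _
  ... | no x≢p   | no x≢q   rewrite A≡B x x≢p x≢q = refl

closedNbhdSum≡∑ : ∀ n c k (f : Fin n → Fin n) v →
  closedNbhdSum n c k f v ≡ ∑ (restrict (inClosedNbhd n c k v) (suc ∘ toℕ ∘ f))
closedNbhdSum≡∑ n c k f v = sum-map-tabulate id (restrict (inClosedNbhd n c k v) (suc ∘ toℕ ∘ f))

exchange⇒¬closedDistanceMagic : ∀ {n c k} (v w p q : Fin n) →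
  inClosedNbhd n c k v p ≡ false → inClosedNbhd n c k w p ≡ true →
  inClosedNbhd n c k v q ≡ true → inClosedNbhd n c k w q ≡ false →
  (∀ x → x ≢ p → x ≢ q → inClosedNbhd n c k v x ≡ inClosedNbhd n c k w x) →
  ¬ CirculantClosedDistanceMagic n c k
exchange⇒¬closedDistanceMagic {n} {c} {k} v w p q vp wp vq wq v≡w (ℓ , k' , _ , magic) = p≢q p≡q
  where
  p≢q : p ≢ q
  p≢q refl = contradiction (trans (sym vp) vq) λ ()
  label : Vector ℕ n
  label = suc ∘ toℕ ∘ Bijection.to ℓ
  sum≡k' : ∀ u → ∑ (restrict (inClosedNbhd n c k u) label) ≡ k'
  sum≡k' u = trans (sym (closedNbhdSum≡∑ n c k (Bijection.to ℓ) u)) (magic u)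
  p≡q : p ≡ q
  p≡q = Bijection.injective ℓ (toℕ-injective (suc-injective (+-cancelˡ-≡ k' _ _ (begin
    k' + label p                                         ≡⟨ cong (_+ label p) (sum≡k' v) ⟨
    ∑ (restrict (inClosedNbhd n c k v) label) + label p  ≡⟨ sum-restrict-exchange label _ _ vp wp vq wq v≡w ⟩
    ∑ (restrict (inClosedNbhd n c k w) label) + label q  ≡⟨ cong (_+ label q) (sum≡k' w) ⟩
    k' + label q                                         ∎))))
    where open ≡-Reasoning

-- InN₀ t and InNc t say that v_t ∈ N[v₀] and v_t ∈ N[v_c]; P = (k+1)c and Q = n − kc.
module Shift {c k s : ℕ} (c>0 : 0 < c) (k>0 : 0 < k) (s>0 : 0 < s) (s≢c : s ≢ c) where

  K n P Q : ℕ
  K = k * c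
  n = K + (K + s)
  P = c + K
  Q = K + s

  InN₀ InNc : ℕ → Set
  InN₀ t = SignedMultiple n c k t
  InNc t = SignedMultiple n c k ∣ c - t ∣

  j*c≤K : ∀ {j} → j ≤ k → j * c ≤ K
  j*c≤K = *-monoˡ-≤ c

  c≤K : c ≤ K
  c≤K = m≤n*m c k {{>-nonZero k>0}}

  K<Q : K < Q
  K<Q = m<m+n K s>0

  Q<n : Q < n
  Q<n = m<n+m Q (<-≤-trans c>0 c≤K)

  c+K≢Q : c + K ≢ Q
  c+K≢Q eq = s≢c (sym (+-cancelˡ-≡ K c s (trans (+-comm K c) eq)))

  K+K<n : K + K < n
  K+K<n = +-monoʳ-< K (m<m+n K s>0)

  InN₀⇒InNc : ∀ {t} → t < n → t ≢ Q → InN₀ t → InNc t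
  InN₀⇒InNc _ _ (zero , _ , inj₁ refl) = 1 , k>0 , inj₁ (trans (∣-∣-identityʳ c) (sym (+-identityʳ c)))
  InN₀⇒InNc _ _ (suc j , j<k , inj₁ refl) = j , <⇒≤ j<k , inj₁ (∣m-m+n∣≡n c (j * c))
  InN₀⇒InNc t<n _ (zero , _ , inj₂ t+0≡n) = contradiction (trans (sym (+-identityʳ _)) t+0≡n) (<⇒≢ t<n)
  InN₀⇒InNc {t} _ t≢Q (suc j , j<k , inj₂ eq) with m≤n⇒m<n∨m≡n j<k
  ... | inj₂ refl = contradiction (+-cancelˡ-≡ K t Q (trans (+-comm K t) eq)) t≢Q
  ... | inj₁ j+1<k with m≤n⇒∃[o]m+o≡n {c} {t} (≤-trans c≤K (<⇒≤ (<-≤-trans K<Q Q≤t)))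
    where
    Q≤t : Q ≤ t
    Q≤t = m+n≡o+p∧n≤o⇒p≤m eq (j*c≤K j<k)
  ...   | u , refl = suc (suc j) , j+1<k ,
    inj₂ (trans (cong (_+ _) (∣m-m+n∣≡n c u)) (trans (sym (xy∙z≈y∙xz c u _)) eq))

  InN₀-c+ : ∀ {u} → c + u < n → c + u ≢ P → InN₀ u → InN₀ (c + u)
  InN₀-c+ _ c+u≢P (j , j≤k , inj₁ refl) with m≤n⇒m<n∨m≡n j≤k
  ... | inj₁ j<k = suc j , j<k , inj₁ refl
  ... | inj₂ refl = contradiction refl c+u≢P
  InN₀-c+ {u} c+u<n _ (zero , _ , inj₂ u+0≡n) =
    contradiction (trans (sym (+-identityʳ u)) u+0≡n) (<⇒≢ (≤-<-trans (m≤n+m u c) c+u<n))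
  InN₀-c+ {u} _ _ (suc j , j<k , inj₂ eq) = j , <⇒≤ j<k , inj₂ (trans (xy∙z≈y∙xz c u _) eq)

  InN₀-∸ : ∀ {t} → t ≤ c → InN₀ (c ∸ t) → InN₀ t
  InN₀-∸ {zero} _ _ = 0 , z≤n , inj₁ refl
  InN₀-∸ {suc t} t<c (zero , _ , inj₁ c∸t≡0) =
    1 , k>0 , inj₁ (trans (≤-antisym t<c (m∸n≡0⇒m≤n c∸t≡0)) (sym (+-identityʳ c)))
  InN₀-∸ {suc t} t<c (suc j , _ , inj₁ c∸t≡c+jc) =
    contradiction (subst (_< c) c∸t≡c+jc (∸-monoʳ-< z<s t<c)) (m+n≮m c (j * c))
  InN₀-∸ {t} _ (j , j≤k , inj₂ eq) = contradiction (begin-strict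
    n                  ≡⟨ eq ⟨
    (c ∸ t) + j * c    ≤⟨ +-mono-≤ (≤-trans (m∸n≤m c t) c≤K) (j*c≤K j≤k) ⟩
    K + K              <⟨ K+K<n ⟩
    n                  ∎) (<-irrefl refl)
    where open ≤-Reasoning

  InNc⇒InN₀ : ∀ {t} → t < n → t ≢ P → InNc t → InN₀ t
  InNc⇒InN₀ {t} t<n t≢P t∈Nc with ≤-total c t
  ... | inj₂ t≤c = InN₀-∸ t≤c (subst InN₀ (m≤n⇒∣n-m∣≡n∸m t≤c) t∈Nc)
  ... | inj₁ c≤t with m≤n⇒∃[o]m+o≡n c≤t
  ...   | u , refl = InN₀-c+ t<n t≢P (subst InN₀ (∣m-m+n∣≡n c u) t∈Nc)

  c+j*c≢Q : ∀ {j} → j ≤ k → c + j * c ≢ Q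
  c+j*c≢Q j≤k with m≤n⇒m<n∨m≡n j≤k
  ... | inj₂ refl = c+K≢Q
  ... | inj₁ j<k = <⇒≢ (≤-<-trans (j*c≤K j<k) K<Q)

  ¬InN₀-P : ¬ InN₀ P
  ¬InN₀-P (j , j≤k , inj₁ eq) = <⇒≱ (m<n+m K c>0) (subst (_≤ K) (sym eq) (j*c≤K j≤k))
  ¬InN₀-P (j , j≤k , inj₂ eq) = c+j*c≢Q j≤k (+-cancelˡ-≡ K _ _ (trans (sym (xy∙z≈y∙xz c K _)) eq))

  InNc-P : InNc P
  InNc-P = k , ≤-refl , inj₁ (∣m-m+n∣≡n c K)

  InN₀-Q : InN₀ Q
  InN₀-Q = k , ≤-refl , inj₂ (+-comm Q K)

  ¬InNc-Q : ¬ InNc Q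
  ¬InNc-Q Q∈Nc with m≤n⇒∃[o]m+o≡n {c} {Q} (≤-trans c≤K (<⇒≤ K<Q))
  ... | u , c+u≡Q with subst InN₀ (trans (cong (∣ c -_∣) (sym c+u≡Q)) (∣m-m+n∣≡n c u)) Q∈Nc
  ...   | j , j≤k , inj₁ refl = c+j*c≢Q j≤k c+u≡Q
  ...   | j , j≤k , inj₂ eq = <⇒≱ (m<n+m n c>0) (begin
    c + n            ≡⟨ cong (c +_) eq ⟨
    c + (u + j * c)  ≡⟨ +-assoc c u _ ⟨
    (c + u) + j * c  ≡⟨ cong (_+ j * c) c+u≡Q ⟩
    Q + j * c        ≤⟨ +-monoʳ-≤ Q (j*c≤K j≤k) ⟩
    Q + K            ≡⟨ +-comm Q K ⟩
    n                ∎)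
    where open ≤-Reasoning

  c<n : c < n
  c<n = ≤-<-trans c≤K (<-trans K<Q Q<n)

  0<n : 0 < n
  0<n = ≤-<-trans z≤n c<n

  P<n : P < n
  P<n = ≤-<-trans (+-monoˡ-≤ K c≤K) K+K<n

  v₀ v꜀ p q : Fin n
  v₀ = fromℕ< 0<n
  v꜀ = fromℕ< c<n
  p = fromℕ< P<n
  q = fromℕ< Q<n

  N[v₀]⇔ : ∀ x → inClosedNbhd n c k v₀ x ≡ true ⇔ InN₀ (toℕ x)
  N[v₀]⇔ x = subst (λ a → inClosedNbhd n c k v₀ x ≡ true ⇔ SignedMultiple n c k ∣ a - toℕ x ∣)
    (toℕ-fromℕ< 0<n) (inClosedNbhd≡true⇔ (<⇒≤ K+K<n) v₀ x)

  N[v꜀]⇔ : ∀ x → inClosedNbhd n c k v꜀ x ≡ true ⇔ InNc (toℕ x)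
  N[v꜀]⇔ x = subst (λ a → inClosedNbhd n c k v꜀ x ≡ true ⇔ SignedMultiple n c k ∣ a - toℕ x ∣)
    (toℕ-fromℕ< c<n) (inClosedNbhd≡true⇔ (<⇒≤ K+K<n) v꜀ x)

  p∉N[v₀] : inClosedNbhd n c k v₀ p ≡ false
  p∉N[v₀] = ¬-not (¬InN₀-P ∘ subst InN₀ (toℕ-fromℕ< P<n) ∘ Equivalence.to (N[v₀]⇔ p))

  p∈N[v꜀] : inClosedNbhd n c k v꜀ p ≡ true
  p∈N[v꜀] = Equivalence.from (N[v꜀]⇔ p) (subst InNc (sym (toℕ-fromℕ< P<n)) InNc-P)

  q∈N[v₀] : inClosedNbhd n c k v₀ q ≡ true
  q∈N[v₀] = Equivalence.from (N[v₀]⇔ q) (subst InN₀ (sym (toℕ-fromℕ< Q<n)) InN₀-Q)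

  q∉N[v꜀] : inClosedNbhd n c k v꜀ q ≡ false
  q∉N[v꜀] = ¬-not (¬InNc-Q ∘ subst InNc (toℕ-fromℕ< Q<n) ∘ Equivalence.to (N[v꜀]⇔ q))

  N[v₀]≡N[v꜀] : ∀ x → x ≢ p → x ≢ q → inClosedNbhd n c k v₀ x ≡ inClosedNbhd n c k v꜀ x
  N[v₀]≡N[v꜀] x x≢p x≢q = ⇔→≡ (mk⇔
    (Equivalence.from (N[v꜀]⇔ x) ∘ InN₀⇒InNc (toℕ<n x) (x≢q ∘ toℕ≡⇒≡ Q<n) ∘ Equivalence.to (N[v₀]⇔ x))
    (Equivalence.from (N[v₀]⇔ x) ∘ InNc⇒InN₀ (toℕ<n x) (x≢p ∘ toℕ≡⇒≡ P<n) ∘ Equivalence.to (N[v꜀]⇔ x)))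
    where
    toℕ≡⇒≡ : ∀ {t} (t<n : t < n) → toℕ x ≡ t → x ≡ fromℕ< t<n
    toℕ≡⇒≡ t<n e = toℕ-injective (trans e (sym (toℕ-fromℕ< t<n)))

  ¬closedDistanceMagic : ¬ CirculantClosedDistanceMagic n c k
  ¬closedDistanceMagic =
    exchange⇒¬closedDistanceMagic {n} {c} {k} v₀ v꜀ p q p∉N[v₀] p∈N[v꜀] q∈N[v₀] q∉N[v꜀] N[v₀]≡N[v꜀]

m≤n/2⇒m+m≤n : ∀ {m n} → m ≤ n / 2 → m + m ≤ n
m≤n/2⇒m+m≤n {m} {n} m≤n/2 = begin
  m + m      ≡⟨ cong (m +_) (+-identityʳ m) ⟨
  2 * m      ≡⟨ *-comm 2 m ⟩
  m * 2      ≤⟨ *-monoˡ-≤ 2 m≤n/2 ⟩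
  n / 2 * 2  ≤⟨ m/n*n≤m n 2 ⟩
  n          ∎
  where open ≤-Reasoning

mainTheorem15 : (n c k : ℕ) → 0 < n → 0 < c → 0 < k → k * c ≤ n / 2 →
    CirculantClosedDistanceMagic n c k →
    (n ≡ 2 * k * c) ⊎ (n ≡ (2 * k + 1) * c)
mainTheorem15 n c k _ c>0 k>0 kc≤n/2 magic with m≤n⇒∃[o]m+o≡n {k * c + k * c} {n} (m≤n/2⇒m+m≤n kc≤n/2)
... | zero , refl = inj₁ (2kc≡ k c)
  where
  2kc≡ : ∀ k c → k * c + k * c + 0 ≡ 2 * k * c
  2kc≡ = solve-∀
... | s@(suc _) , refl with s ≟ c
...   | yes refl = inj₂ (2kc+c≡ k c)
  where
  2kc+c≡ : ∀ k c → k * c + k * c + c ≡ (2 * k + 1) * c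
  2kc+c≡ = solve-∀
...   | no s≢c = contradiction
  (subst (λ m → CirculantClosedDistanceMagic m c k) (+-assoc (k * c) (k * c) s) magic)
  (Shift.¬closedDistanceMagic c>0 k>0 z<s s≢c)
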